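{- Let $(G,k)$ be a reduced yes-instance of diamond-free editing, let $E_\pm$ be a solution of $(G,k)$, and let $uv\in E_\pm$ (an edge or a non-edge of $G$). Then $|N(u)\cap N(v)|\le 3k$.
   Context: Graphs are finite, simple, undirected; $N(v)$ is the set of neighbors of $v$ in $G$. A diamond is $K_4$ minus one edge; a graph is diamond-free if it has no induced diamond. For a set $E_+$ of non-edges of $G$ and a set $E_-$ of edges of $G$, write $E_\pm=E_+\cup E_-$ and $G\triangle E_\pm$ for the graph on $V(G)$ with edge set $(E(G)\cup E_+)\setminus E_-$. A solution of an instance $(G,k)$ of diamond-free editing is such a pair with $G\triangle E_\pm$ diamond-free and $|E_\pm|\le k$; $(G,k)$ is a yes-instance if a solution exists. $(G,k)$ is reduced if (1) there is no non-edge $uv$ together with $2k+2$ distinct vertices $x_1,y_1,\dots,x_{k+1},y_{k+1}\in N(u)\cap N(v)$ with $x_iy_i\in E(G)$ for all $i$, and (2) there is no edge $uv$ together with $2k+2$ distinct vertices $x_1,y_1,\dots,x_{k+1},y_{k+1}\in N(u)\cap N(v)$ with $x_iy_i\notin E(G)$ for all $i$. -}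

module Defs where

open import Data.Nat using (ℕ; suc; _+_; _*_; _≤_)
open import Data.Fin using (Fin; _<_; _≟_)
open import Data.Bool using (Bool; true; false; _∧_; _∨_; _xor_; not; T; if_then_else_)
open import Data.Bool.Properties using (T?)
open import Data.List using (List; []; _∷_; length; filter; allFin)
open import Data.List.Relation.Unary.All using (All)
open import Data.List.Relation.Unary.Unique.Propositional using (Unique)
open import Data.Product using (_×_; _,_; proj₁; proj₂; ∃)
open import Data.Sum using (_⊎_; [_,_])
open import Relation.Nullary using (¬_; does)
open import Relation.Binary.PropositionalEquality using (_≡_; _≢_)
open import Function.Definitions using (Injective)

record Graph (n : ℕ) : Set where
  field
    adj    : Fin n → Fin n → Bool
    adj-sym    : ∀ x y → adj x y ≡ adj y x
    adj-irrefl : ∀ x → adj x x ≡ false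
open Graph public

Edge : ∀ {n} → Graph n → Fin n → Fin n → Set
Edge G x y = adj G x y ≡ true

commonNbrs : ∀ {n} → Graph n → Fin n → Fin n → ℕ
commonNbrs {n} G u v = length (filter (λ x → T? (adj G u x ∧ adj G v x)) (allFin n))

Diamond : ∀ {n} → Graph n → Fin n → Fin n → Fin n → Fin n → Set
Diamond G a b c d =
  a ≢ b × a ≢ c × a ≢ d × b ≢ c × b ≢ d × c ≢ d ×
  Edge G a b × Edge G a c × Edge G a d × Edge G b c × Edge G b d × ¬ Edge G c d

DiamondFree : ∀ {n} → Graph n → Set
DiamondFree G = ∀ a b c d → ¬ Diamond G a b c d

-- An edit set E± is a list of unordered pairs, each stored as (x , y) with x < y,
-- without repetitions; its size |E±| is the length of the list.
-- Pairs in E± that are edges of G form E₋, pairs that are non-edges form E₊.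
EditSet : ℕ → Set
EditSet n = List (Fin n × Fin n)

WellFormedEdits : ∀ {n} → EditSet n → Set
WellFormedEdits E = All (λ p → proj₁ p < proj₂ p) E × Unique E

memB : ∀ {n} → Fin n → Fin n → EditSet n → Bool
memB x y [] = false
memB x y ((a , b) ∷ E) = (does (x ≟ a) ∧ does (y ≟ b)) ∨ memB x y E

inEditsB : ∀ {n} → EditSet n → Fin n → Fin n → Bool
inEditsB E x y = memB x y E ∨ memB y x E

InEdits : ∀ {n} → EditSet n → Fin n → Fin n → Set
InEdits E x y = inEditsB E x y ≡ true

edit : ∀ {n} → Graph n → EditSet n → Graph n
edit G E = record
  { adj    = ad
  ; adj-sym    = symP
  ; adj-irrefl = irr }
  where
  open import Relation.Nullary using (yes; no)
  open import Relation.Binary.PropositionalEquality using (refl; sym; cong₂)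
  open import Data.Bool.Properties using (∨-comm)
  ad : _ → _ → Bool
  ad x y = if does (x ≟ y) then false else (adj G x y xor inEditsB E x y)
  symP : ∀ x y → ad x y ≡ ad y x
  symP x y with x ≟ y | y ≟ x
  ... | yes _ | yes _ = refl
  ... | yes p | no q = Data.Empty.⊥-elim (q (sym p)) where import Data.Empty
  ... | no p | yes q = Data.Empty.⊥-elim (p (sym q)) where import Data.Empty
  ... | no _ | no _ = cong₂ _xor_ (adj-sym G x y) (∨-comm (memB x y E) (memB y x E))
  irr : ∀ x → ad x x ≡ false
  irr x with x ≟ x
  ... | yes _ = refl
  ... | no p = Data.Empty.⊥-elim (p refl) where import Data.Empty

Solution : ∀ {n} → Graph n → ℕ → EditSet n → Set
Solution G k E = WellFormedEdits E × DiamondFree (edit G E) × length E ≤ k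

YesInstance : ∀ {n} → Graph n → ℕ → Set
YesInstance G k = ∃ λ E → Solution G k E

-- 2k+2 distinct vertices x₁,y₁,…,x_{k+1},y_{k+1}, indexed by Fin (suc k) ⊎ Fin (suc k)
-- (left copy = the x's, right copy = the y's)
DistinctPairs : ∀ {n} → ℕ → (Fin n → Fin n → Set) → Graph n → Fin n → Fin n → Set
DistinctPairs {n} k R G u v =
  ∃ λ (x : Fin (suc k) → Fin n) → ∃ λ (y : Fin (suc k) → Fin n) →
    Injective _≡_ _≡_ [ x , y ] ×
    (∀ i → Edge G u (x i) × Edge G v (x i) × Edge G u (y i) × Edge G v (y i) × R (x i) (y i))

Reduced : ∀ {n} → Graph n → ℕ → Set
Reduced G k =
  (∀ u v → u ≢ v → ¬ Edge G u v → ¬ DistinctPairs k (Edge G) G u v) ×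
  (∀ u v → Edge G u v → ¬ DistinctPairs k (λ a b → ¬ Edge G a b) G u v)

module Submission where

-- Suppose uv is edited but u and v have more than 3k common neighbours W.
-- Call an edit "charged" to a list L of vertices if one endpoint lies in L and
-- the other in L ∪ {u, v}; the load of L is the number of charged edits.  The
-- edit uv itself is not charged to W, so load W < |E±| ≤ k.  Scanning W, a
-- greedy procedure either discards a vertex (which lowers the load by one) or
-- takes a pair {a, b} none of whose pairs ua, va, ub, vb, ab is edited (which
-- lowers the length by two); the invariant 2j + load L ≤ |L| then yields k+1
-- disjoint such "free" pairs.  In the diamond-free edited graph, u, v, a, b
-- with the four cross edges force uv and ab to be both edges or both
-- non-edges; as uv is toggled and ab is not, ab has in G the adjacency
-- opposite to uv.  These k+1 pairs contradict reduction rule (1) or (2).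

open import Defs
open import Data.Nat using (ℕ; _≤_; _*_)
open import Data.Fin using (Fin)

open import Data.Nat using (zero; suc; _+_; _<_; s≤s; _≤?_)
open import Data.Nat.Properties
  using (≤-trans; ≤-pred; m≤n⇒m≤1+n; <-≤-trans; ≰⇒>; +-monoʳ-≤; +-monoʳ-<; +-suc; *-suc; +-comm)
open import Data.Fin using (zero; suc; _≟_)
open import Data.Fin.Properties using (<-irrefl)
import Data.Fin as Fin
open import Data.Bool using (true; false; not; _xor_; _∧_; _∨_)
open import Data.Bool.Properties using (T?; T-∧; T-≡; xor-identityʳ; xor-comm; true-xor)
open import Data.List using (List; []; _∷_; length; filter; allFin)
open import Data.List.Properties using (filter-notAll)
open import Data.List.Relation.Unary.All using (All; _∷_)
open import Data.List.Relation.Unary.All.Properties using (All¬⇒¬Any)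
open import Data.List.Relation.Unary.Any using (here; there)
import Data.List.Relation.Unary.Any as Any
open import Data.List.Relation.Unary.AllPairs using (_∷_)
open import Data.List.Relation.Unary.Unique.Propositional using (Unique)
open import Data.List.Relation.Unary.Unique.Propositional.Properties using (allFin⁺; filter⁺)
open import Data.List.Membership.Propositional using (_∈_; _∉_)
open import Data.List.Membership.Propositional.Properties using (∈-filter⁻)
open import Data.List.Relation.Binary.Subset.Propositional using (_⊆_)
import Data.List.Relation.Binary.Sublist.Propositional as Sublist
import Data.List.Relation.Binary.Sublist.Propositional.Properties as Sublistₚ
open import Data.Product using (_×_; _,_; proj₁; proj₂; ∃)
open import Data.Sum using (_⊎_; inj₁; inj₂; [_,_]; [_,_]′)
import Data.Sum as Sum
open import Data.Vec.Functional using () renaming (_∷_ to _∷ᶠ_)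
open import Data.Empty using (⊥-elim)
open import Relation.Nullary using (¬_; yes; no; contradiction)
open import Relation.Nullary.Decidable using (_×-dec_; _⊎-dec_)
open import Relation.Unary using (Decidable)
open import Relation.Binary.PropositionalEquality
  using (_≡_; _≢_; refl; sym; trans; cong; subst; ≢-sym; module ≡-Reasoning)
open import Function.Definitions using (Injective)
open import Function.Bundles using (Equivalence)
open import Function.Base using (_∘_)

module _ {A : Set} {P Q : A → Set} (P? : Decidable P) (Q? : Decidable Q)
         (P⊆Q : ∀ {x} → P x → Q x) where

  count-mono : ∀ xs → length (filter P? xs) ≤ length (filter Q? xs)
  count-mono xs = Sublistₚ.length-mono-≤ (Sublistₚ.filter⁺ P? Q? (λ { refl → P⊆Q }) (Sublist.⊆-refl {x = xs}))

  count-strict : ∀ {y} xs → y ∈ xs → Q y → ¬ P y →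
                 length (filter P? xs) < length (filter Q? xs)
  count-strict (x ∷ xs) (here refl) qy ¬py with P? x | Q? x
  ... | yes px | _      = contradiction px ¬py
  ... | no _   | no ¬qx = contradiction qy ¬qx
  ... | no _   | yes _  = s≤s (count-mono xs)
  count-strict (x ∷ xs) (there y∈xs) qy ¬py with P? x | Q? x
  ... | yes _  | yes _  = s≤s (count-strict xs y∈xs qy ¬py)
  ... | yes px | no ¬qx = contradiction (P⊆Q px) ¬qx
  ... | no _   | yes _  = m≤n⇒m≤1+n (count-strict xs y∈xs qy ¬py)
  ... | no _   | no _   = count-strict xs y∈xs qy ¬py

-- The arithmetic of the greedy invariant  2j + load ≤ length  follows.
-- Discarding one element that lowers the load preserves the invariant.
drop-one : ∀ m {c d b} → m + c ≤ suc b → d < c → m + d ≤ b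
drop-one m h d<c = ≤-pred (<-≤-trans (+-monoʳ-< m d<c) h)

double-suc : ∀ j c → 2 * suc j + c ≡ suc (suc (2 * j + c))
double-suc j c = cong (_+ c) (*-suc 2 j)

-- Taking a pair of elements (without raising the load) lowers j by one.
take-pair : ∀ j {c d b} → 2 * suc j + c ≤ suc (suc b) → d ≤ c → 2 * j + d ≤ b
take-pair j {c} {b = b} h d≤c =
  ≤-trans (+-monoʳ-≤ (2 * j) d≤c) (≤-pred (≤-pred (subst (_≤ suc (suc b)) (double-suc j c) h)))

-- A nonempty family of pairs cannot fit into fewer than two elements.
no-room : ∀ j {c} → ¬ (2 * suc j + c ≤ 1)
no-room j {c} h with subst (_≤ 1) (double-suc j c) h
... | s≤s ()

-- The initial invariant: load c < k and more than 3k elements leave room for k+1 pairs.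
initial-room : ∀ k {c m} → c < k → 3 * k < m → 2 * suc k + c ≤ m
initial-room k {c} {m} c<k 3k<m = begin
  2 * suc k + c         ≡⟨ double-suc k c ⟩
  suc (suc (2 * k + c)) ≡⟨ cong suc (sym (+-suc (2 * k) c)) ⟩
  suc (2 * k + suc c)   ≤⟨ s≤s (+-monoʳ-≤ (2 * k) c<k) ⟩
  suc (2 * k + k)       ≡⟨ cong suc (+-comm (2 * k) k) ⟩
  suc (3 * k)           ≤⟨ 3k<m ⟩
  m                     ∎
  where open Data.Nat.Properties.≤-Reasoning

module _ {A : Set} {j : ℕ} where

  private
    data Slot : Fin (suc j) ⊎ Fin (suc j) → Set where
      new₁ : Slot (inj₁ zero)
      new₂ : Slot (inj₂ zero)
      old  : (c : Fin j ⊎ Fin j) → Slot (Sum.map suc suc c)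

    slot : ∀ c → Slot c
    slot (inj₁ zero)    = new₁
    slot (inj₂ zero)    = new₂
    slot (inj₁ (suc i)) = old (inj₁ i)
    slot (inj₂ (suc i)) = old (inj₂ i)

    shift : ∀ (a b : A) (x y : Fin j → A) d → [ a ∷ᶠ x , b ∷ᶠ y ]′ (Sum.map suc suc d) ≡ [ x , y ]′ d
    shift a b x y (inj₁ i) = refl
    shift a b x y (inj₂ i) = refl

  cons-injective : (a b : A) (x y : Fin j → A) → a ≢ b →
    (∀ c → a ≢ [ x , y ] c) → (∀ c → b ≢ [ x , y ] c) →
    Injective _≡_ _≡_ [ x , y ] → Injective _≡_ _≡_ [ a ∷ᶠ x , b ∷ᶠ y ]
  cons-injective a b x y a≢b a-fresh b-fresh inj {c} {c'} e with slot c | slot c'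
  ... | new₁  | new₁   = refl
  ... | new₂  | new₂   = refl
  ... | new₁  | new₂   = contradiction e a≢b
  ... | new₂  | new₁   = contradiction (sym e) a≢b
  ... | new₁  | old d' = contradiction (trans e (shift a b x y d')) (a-fresh d')
  ... | new₂  | old d' = contradiction (trans e (shift a b x y d')) (b-fresh d')
  ... | old d | new₁   = contradiction (trans (sym e) (shift a b x y d)) (a-fresh d)
  ... | old d | new₂   = contradiction (trans (sym e) (shift a b x y d)) (b-fresh d)
  ... | old d | old d' = cong (Sum.map suc suc) (inj {d} {d'} (trans (sym (shift a b x y d)) (trans e (shift a b x y d'))))

Untouched : ∀ {n} → EditSet n → Fin n → Fin n → Set
Untouched E x y = inEditsB E x y ≡ false

untouched-or-edited : ∀ {n} (E : EditSet n) x y → Untouched E x y ⊎ InEdits E x y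
untouched-or-edited E x y with inEditsB E x y
... | false = inj₁ refl
... | true  = inj₂ refl

memB-sound : ∀ {n} (x y : Fin n) (E : EditSet n) → memB x y E ≡ true → (x , y) ∈ E
memB-sound x y ((a , b) ∷ E) h with x ≟ a | y ≟ b
... | yes refl | yes refl = here refl
... | yes _    | no _     = there (memB-sound x y E h)
... | no _     | yes _    = there (memB-sound x y E h)
... | no _     | no _     = there (memB-sound x y E h)

inEdits-sound : ∀ {n} (E : EditSet n) {x y} → InEdits E x y → (x , y) ∈ E ⊎ (y , x) ∈ E
inEdits-sound E {x} {y} h with memB x y E in xy
... | true  = inj₁ (memB-sound x y E xy)
... | false = inj₂ (memB-sound y x E h)

memB-diagonal : ∀ {n} (x : Fin n) (E : EditSet n) →
                All (λ p → proj₁ p Fin.< proj₂ p) E → memB x x E ≡ false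
memB-diagonal x [] _ = refl
memB-diagonal x ((a , b) ∷ E) (a<b ∷ ordered) with x ≟ a | x ≟ b
... | yes refl | yes refl = contradiction a<b (<-irrefl refl)
... | yes _    | no _     = memB-diagonal x E ordered
... | no _     | yes _    = memB-diagonal x E ordered
... | no _     | no _     = memB-diagonal x E ordered

edited-distinct : ∀ {n} (E : EditSet n) → All (λ p → proj₁ p Fin.< proj₂ p) E →
                  ∀ {x y} → InEdits E x y → x ≢ y
edited-distinct E ordered {x} h refl with trans (sym h) (cong (λ b → b ∨ b) (memB-diagonal x E ordered))
... | ()

edit-adj : ∀ {n} (G : Graph n) (E : EditSet n) {x y} → x ≢ y →
           adj (edit G E) x y ≡ (adj G x y xor inEditsB E x y)
edit-adj G E {x} {y} x≢y with x ≟ y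
... | yes x≡y = contradiction x≡y x≢y
... | no _    = refl

edit-keeps : ∀ {n} (G : Graph n) (E : EditSet n) {x y} → x ≢ y → Untouched E x y →
             adj (edit G E) x y ≡ adj G x y
edit-keeps G E {x} {y} x≢y untouched = begin
  adj (edit G E) x y             ≡⟨ edit-adj G E x≢y ⟩
  adj G x y xor inEditsB E x y   ≡⟨ cong (adj G x y xor_) untouched ⟩
  adj G x y xor false            ≡⟨ xor-identityʳ (adj G x y) ⟩
  adj G x y                      ∎
  where open ≡-Reasoning

edit-flips : ∀ {n} (G : Graph n) (E : EditSet n) {x y} → x ≢ y → InEdits E x y →
             adj (edit G E) x y ≡ not (adj G x y)
edit-flips G E {x} {y} x≢y edited = begin
  adj (edit G E) x y             ≡⟨ edit-adj G E x≢y ⟩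
  adj G x y xor inEditsB E x y   ≡⟨ cong (adj G x y xor_) edited ⟩
  adj G x y xor true             ≡⟨ xor-comm (adj G x y) true ⟩
  true xor adj G x y             ≡⟨ true-xor (adj G x y) ⟩
  not (adj G x y)                ∎
  where open ≡-Reasoning

edge-distinct : ∀ {n} (H : Graph n) {x y} → Edge H x y → x ≢ y
edge-distinct H {x} xy refl with trans (sym xy) (adj-irrefl H x)
... | ()

edge-sym : ∀ {n} (H : Graph n) {x y} → Edge H x y → Edge H y x
edge-sym H {x} {y} xy = trans (adj-sym H y x) xy

non-edge : ∀ {n} (H : Graph n) {x y} → adj H x y ≡ false → ¬ Edge H x y
non-edge H no-xy xy with trans (sym xy) no-xy
... | ()

CommonNbr : ∀ {n} → Graph n → Fin n → Fin n → Fin n → Set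
CommonNbr H u v a = Edge H u a × Edge H v a

-- The diamond lemma: in a diamond-free graph, if u ≢ v and a ≢ b are such that a and b
-- are common neighbours of u and v, then uv is an edge exactly when ab is
-- (otherwise u, v, a, b induce a diamond).
diamond-free-square : ∀ {n} (H : Graph n) → DiamondFree H → ∀ {u v a b} → u ≢ v → a ≢ b →
                      CommonNbr H u v a → CommonNbr H u v b → adj H u v ≡ adj H a b
diamond-free-square H free {u} {v} {a} {b} u≢v a≢b (ua , va) (ub , vb) =
  agree (adj H u v) (adj H a b) refl refl
  where
  u≢a : u ≢ a
  u≢a = edge-distinct H ua
  u≢b : u ≢ b
  u≢b = edge-distinct H ub
  v≢a : v ≢ a
  v≢a = edge-distinct H va
  v≢b : v ≢ b
  v≢b = edge-distinct H vb
  agree : ∀ p q → adj H u v ≡ p → adj H a b ≡ q → p ≡ q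
  agree true  true  _  _  = refl
  agree false false _  _  = refl
  agree true  false uv ab = ⊥-elim (free u v a b
    (u≢v , u≢a , u≢b , v≢a , v≢b , a≢b , uv , ua , ub , va , vb , non-edge H ab))
  agree false true  uv ab = ⊥-elim (free a b u v
    (a≢b , ≢-sym u≢a , ≢-sym v≢a , ≢-sym u≢b , ≢-sym v≢b , u≢v ,
     ab , edge-sym H ua , edge-sym H va , edge-sym H ub , edge-sym H vb , non-edge H uv))

module FreePairs {n : ℕ} (E : EditSet n) (u v : Fin n) where
  open import Data.List.Membership.DecPropositional (_≟_ {n}) using (_∈?_)

  Clean : Fin n → Set
  Clean a = Untouched E u a × Untouched E v a

  record FreePair (a b : Fin n) : Set where
    field
      distinct : a ≢ b
      clean₁   : Clean a
      clean₂   : Clean b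
      unedited : Untouched E a b

  record PairFamily (j : ℕ) (L : List (Fin n)) : Set where
    field
      fst snd   : Fin j → Fin n
      injective : Injective _≡_ _≡_ [ fst , snd ]
      free      : ∀ i → FreePair (fst i) (snd i)
      inside    : ∀ c → [ fst , snd ] c ∈ L

  open PairFamily

  none : ∀ {L} → PairFamily 0 L
  none = record
    { fst = λ (); snd = λ (); injective = λ { {inj₁ ()} ; {inj₂ ()} }
    ; free = λ (); inside = λ { (inj₁ ()) ; (inj₂ ()) } }

  widen : ∀ {j L L'} → L ⊆ L' → PairFamily j L → PairFamily j L'
  widen L⊆L' F = record
    { fst = fst F; snd = snd F; injective = injective F; free = free F
    ; inside = λ c → L⊆L' (inside F c) }

  extend : ∀ {j a b L} → FreePair a b → a ∉ L → b ∉ L → PairFamily j L →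
           PairFamily (suc j) (a ∷ b ∷ L)
  extend {a = a} {b} {L} ab a∉L b∉L F = record
    { fst       = a ∷ᶠ fst F
    ; snd       = b ∷ᶠ snd F
    ; injective = cons-injective a b (fst F) (snd F) (FreePair.distinct ab)
                    (fresh a∉L) (fresh b∉L) (injective F)
    ; free      = λ { zero → ab ; (suc i) → free F i }
    ; inside    = λ { (inj₁ zero) → here refl ; (inj₂ zero) → there (here refl)
                    ; (inj₁ (suc i)) → there (there (inside F (inj₁ i)))
                    ; (inj₂ (suc i)) → there (there (inside F (inj₂ i))) } }
    where
    fresh : ∀ {z} → z ∉ L → ∀ c → z ≢ [ fst F , snd F ] c
    fresh z∉L c refl = z∉L (inside F c)

  Near : List (Fin n) → Fin n → Set
  Near L a = a ∈ L ⊎ (a ≡ u ⊎ a ≡ v)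

  near? : ∀ L → Decidable (Near L)
  near? L a = (a ∈? L) ⊎-dec ((a ≟ u) ⊎-dec (a ≟ v))

  far : ∀ {a L L'} → a ∈ L → u ∉ L → v ∉ L → a ∉ L' → ¬ Near L' a
  far a∈L u∉L v∉L a∉L' (inj₁ a∈L')         = a∉L' a∈L'
  far a∈L u∉L v∉L a∉L' (inj₂ (inj₁ refl)) = u∉L a∈L
  far a∈L u∉L v∉L a∉L' (inj₂ (inj₂ refl)) = v∉L a∈L

  Charged : List (Fin n) → Fin n × Fin n → Set
  Charged L (a , b) = (a ∈ L ⊎ b ∈ L) × Near L a × Near L b

  charged? : ∀ L → Decidable (Charged L)
  charged? L (a , b) = ((a ∈? L) ⊎-dec (b ∈? L)) ×-dec (near? L a ×-dec near? L b)

  charged-mono : ∀ {L' L} → L' ⊆ L → ∀ {p} → Charged L' p → Charged L p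
  charged-mono L'⊆L {a , b} (meets , near-a , near-b) =
    Sum.map L'⊆L L'⊆L meets , Sum.map₁ L'⊆L near-a , Sum.map₁ L'⊆L near-b

  load : List (Fin n) → ℕ
  load L = length (filter (charged? L) E)

  load-mono : ∀ {L' L} → L' ⊆ L → load L' ≤ load L
  load-mono L'⊆L = count-mono (charged? _) (charged? _) (charged-mono L'⊆L) E

  load-drop : ∀ {L' L a z} → L' ⊆ L → a ∈ L → ¬ Near L' a → Near L z → InEdits E z a →
              load L' < load L
  load-drop {L'} {L} L'⊆L a∈L a-far z-near za with inEdits-sound E za
  ... | inj₁ za∈E = count-strict (charged? L') (charged? L) (charged-mono L'⊆L) E za∈E
                      (inj₂ a∈L , z-near , inj₁ a∈L) (λ (_ , _ , a-near) → a-far a-near)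
  ... | inj₂ az∈E = count-strict (charged? L') (charged? L) (charged-mono L'⊆L) E az∈E
                      (inj₁ a∈L , inj₁ a∈L , z-near) (λ (_ , a-near , _) → a-far a-near)

  uncharged : ∀ {L a b} → a ∉ L → b ∉ L → ¬ Charged L (a , b)
  uncharged a∉L b∉L (inj₁ a∈L , _) = a∉L a∈L
  uncharged a∉L b∉L (inj₂ b∈L , _) = b∉L b∈L

  load-below : ∀ {L} → InEdits E u v → u ∉ L → v ∉ L → load L < length E
  load-below {L} uv u∉L v∉L with inEdits-sound E uv
  ... | inj₁ uv∈E = filter-notAll (charged? L) E (Any.map (λ { refl → uncharged u∉L v∉L }) uv∈E)
  ... | inj₂ vu∈E = filter-notAll (charged? L) E (Any.map (λ { refl → uncharged v∉L u∉L }) vu∈E)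

  clean-or-touched : ∀ a → Clean a ⊎ (∃ λ z → (z ≡ u ⊎ z ≡ v) × InEdits E z a)
  clean-or-touched a with untouched-or-edited E u a | untouched-or-edited E v a
  ... | inj₁ ua | inj₁ va = inj₁ (ua , va)
  ... | inj₂ ua | _       = inj₂ (u , inj₁ refl , ua)
  ... | inj₁ _  | inj₂ va = inj₂ (v , inj₂ refl , va)

  partner-or-charged : ∀ w w' R → (Clean w' × Untouched E w w') ⊎
                       (∃ λ z → Near (w ∷ w' ∷ R) z × InEdits E z w')
  partner-or-charged w w' R with clean-or-touched w' | untouched-or-edited E w w'
  ... | inj₁ w'-clean        | inj₁ ww' = inj₁ (w'-clean , ww')
  ... | inj₁ _               | inj₂ ww' = inj₂ (w , inj₁ (here refl) , ww')
  ... | inj₂ (z , z∈uv , zw') | _       = inj₂ (z , inj₂ z∈uv , zw')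

  -- A touched head is discarded; a clean head w is handed
  -- to `pair-with w`, which discards unsuitable partners until it finds one.
  greedy : ∀ j L → Unique L → u ∉ L → v ∉ L → 2 * j + load L ≤ length L → PairFamily j L
  pair-with : ∀ j w R → Unique (w ∷ R) → u ∉ w ∷ R → v ∉ w ∷ R → Clean w →
              2 * j + load (w ∷ R) ≤ length (w ∷ R) → PairFamily j (w ∷ R)

  greedy zero    L       _ _ _ _ = none
  greedy (suc j) []      _ _ _ h = ⊥-elim (no-room j (m≤n⇒m≤1+n h))
  greedy (suc j) (w ∷ R) uniq@(w∉R ∷ uniq-R) u∉L v∉L h with clean-or-touched w
  ... | inj₁ w-clean = pair-with (suc j) w R uniq u∉L v∉L w-clean h
  ... | inj₂ (z , z∈uv , zw) =
    widen there (greedy (suc j) R uniq-R (u∉L ∘ there) (v∉L ∘ there) (drop-one (2 * suc j) h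
      (load-drop there (here refl) (far (here refl) u∉L v∉L (All¬⇒¬Any w∉R)) (inj₂ z∈uv) zw)))

  pair-with zero    w R        _ _ _ _ _ = none
  pair-with (suc j) w []       _ _ _ _ h = ⊥-elim (no-room j h)
  pair-with (suc j) w (w' ∷ R) ((w≢w' ∷ w∉R) ∷ (w'∉R ∷ uniq-R)) u∉L v∉L w-clean h
    with partner-or-charged w w' R
  ... | inj₁ (w'-clean , ww') =
    extend (record { distinct = w≢w' ; clean₁ = w-clean ; clean₂ = w'-clean ; unedited = ww' })
      (All¬⇒¬Any w∉R) (All¬⇒¬Any w'∉R)
      (greedy j R uniq-R (u∉L ∘ there ∘ there) (v∉L ∘ there ∘ there)
        (take-pair j h (load-mono (there ∘ there))))
  ... | inj₂ (z , z-near , zw') =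
    widen skip (pair-with (suc j) w R (w∉R ∷ uniq-R) (u∉L ∘ skip) (v∉L ∘ skip) w-clean
      (drop-one (2 * suc j) h
        (load-drop skip (there (here refl)) (far (there (here refl)) u∉L v∉L w'∉wR) z-near zw')))
    where
    skip : w ∷ R ⊆ w ∷ w' ∷ R
    skip (here refl) = here refl
    skip (there x∈R) = there (there x∈R)
    w'∉wR : w' ∉ w ∷ R
    w'∉wR (here w'≡w) = w≢w' (sym w'≡w)
    w'∉wR (there w'∈R) = All¬⇒¬Any w'∉R w'∈R

open FreePairs using (FreePair; PairFamily; greedy; load-below)

commonList : ∀ {n} → Graph n → Fin n → Fin n → List (Fin n)
commonList {n} G u v = filter (λ x → T? (adj G u x ∧ adj G v x)) (allFin n)

commonList-sound : ∀ {n} (G : Graph n) {u v x} → x ∈ commonList G u v → CommonNbr G u v x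
commonList-sound {n} G {u} {v} x∈W
  with Equivalence.to T-∧ (proj₂ (∈-filter⁻ (λ x → T? (adj G u x ∧ adj G v x)) {xs = allFin n} x∈W))
... | ux , vx = Equivalence.to T-≡ ux , Equivalence.to T-≡ vx

many-free-pairs : ∀ {n} (G : Graph n) k (E : EditSet n) {u v} → length E ≤ k → InEdits E u v →
                  3 * k < commonNbrs G u v → PairFamily E u v (suc k) (commonList G u v)
many-free-pairs {n} G k E {u} {v} |E|≤k uv many =
  greedy E u v (suc k) W unique u∉W v∉W
    (initial-room k (<-≤-trans (load-below E u v uv u∉W v∉W) |E|≤k) many)
  where
  W : List (Fin n)
  W = commonList G u v
  unique : Unique W
  unique = filter⁺ (λ x → T? (adj G u x ∧ adj G v x)) (allFin⁺ n)
  u∉W : u ∉ W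
  u∉W u∈W = edge-distinct G (proj₁ (commonList-sound G u∈W)) refl
  v∉W : v ∉ W
  v∉W v∈W = edge-distinct G (proj₂ (commonList-sound G v∈W)) refl

-- If the edited graph is diamond-free and uv is edited, then each free pair {a , b} of
-- common neighbours has in G the adjacency opposite to that of uv: in G △ E± the
-- diamond lemma equates the (toggled) pair uv with the (untouched) pair ab.
opposite-pairs : ∀ {n} (G : Graph n) k (E : EditSet n) {u v} → DiamondFree (edit G E) →
                 u ≢ v → InEdits E u v → PairFamily E u v (suc k) (commonList G u v) →
                 DistinctPairs k (λ a b → adj G a b ≡ not (adj G u v)) G u v
opposite-pairs {n} G k E {u} {v} diamond-free u≢v uv F =
  fst , snd , injective ,
  λ i → opposite (free i) (commonList-sound G (inside (inj₁ i))) (commonList-sound G (inside (inj₂ i)))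
  where
  open PairFamily F
  G′ : Graph n
  G′ = edit G E

  kept : ∀ {a} → CommonNbr G u v a → FreePairs.Clean E u v a → CommonNbr G′ u v a
  kept (ua , va) (u-a , v-a) =
    trans (edit-keeps G E (edge-distinct G ua) u-a) ua , trans (edit-keeps G E (edge-distinct G va) v-a) va

  opposite : ∀ {a b} → FreePair E u v a b → CommonNbr G u v a → CommonNbr G u v b →
             Edge G u a × Edge G v a × Edge G u b × Edge G v b × adj G a b ≡ not (adj G u v)
  opposite {a} {b} ab a-common@(ua , va) b-common@(ub , vb) = ua , va , ub , vb , (begin
    adj G a b   ≡⟨ sym (edit-keeps G E distinct unedited) ⟩
    adj G′ a b  ≡⟨ sym (diamond-free-square G′ diamond-free u≢v distinct
                          (kept a-common clean₁) (kept b-common clean₂)) ⟩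
    adj G′ u v  ≡⟨ edit-flips G E u≢v uv ⟩
    not (adj G u v) ∎)
    where
    open ≡-Reasoning
    open FreePair ab

pairs-map : ∀ {n k} {R R' : Fin n → Fin n → Set} {G : Graph n} {u v} →
            (∀ {a b} → R a b → R' a b) → DistinctPairs k R G u v → DistinctPairs k R' G u v
pairs-map R⇒R' (x , y , inj , props) =
  x , y , inj , λ i → let (ua , va , ub , vb , r) = props i in ua , va , ub , vb , R⇒R' r

reduced-forbids : ∀ {n} (G : Graph n) k → Reduced G k → ∀ {u v} → u ≢ v →
                  ¬ DistinctPairs k (λ a b → adj G a b ≡ not (adj G u v)) G u v
reduced-forbids G k (rule₁ , rule₂) {u} {v} u≢v pairs with adj G u v in uv
... | false = rule₁ u v u≢v (non-edge G uv) pairs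
... | true  = rule₂ u v uv (pairs-map {G = G} (λ {a} {b} → non-edge G {a} {b}) pairs)

proposition3 : ∀ {n} (G : Graph n) (k : ℕ) (E : EditSet n) →
    Reduced G k → Solution G k E →
    ∀ u v → InEdits E u v → commonNbrs G u v ≤ 3 * k
proposition3 G k E reduced ((ordered , _) , diamond-free , |E|≤k) u v uv
  with commonNbrs G u v ≤? 3 * k
... | yes few  = few
... | no many = ⊥-elim (reduced-forbids G k reduced u≢v
                  (opposite-pairs G k E diamond-free u≢v uv
                    (many-free-pairs G k E |E|≤k uv (≰⇒> many))))
  where
  u≢v : u ≢ v
  u≢v = edited-distinct E ordered uv
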